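{- Let $\Sigma$ be a finite alphabet and $\Sigma_\Box := \Sigma \cup \{\Box\}$. There is a term $\mathtt{lift}_\Sigma$ of $\Lambda_{\tt det}$ such that for every continuation $k$ (a value) and every $s \in \Sigma^*$, $$\mathtt{lift}_\Sigma\; k\; \ulcorner s\urcorner_{\Sigma^*} \rightarrow_{det}^{\Theta(|s|)} k\; \ulcorner s\urcorner_{\Sigma_\Box^*}.$$
   Context: $\Lambda_{\tt det}$: terms $t ::= v \mid t\,v$, values $v ::= \lambda x.t \mid x$; evaluation contexts $E ::= [\cdot] \mid E\,v$; reduction $E[(\lambda x.t)s] \rightarrow_{det} E[t\{x:=s\}]$. $\rightarrow_{det}^{\Theta(|s|)}$ denotes a reduction sequence whose number of steps is $\Theta(|s|)$, where constants may depend on $\Sigma$ (considered fixed). Scott encoding: for an ordered alphabet $\Delta=\{a_1,\dots,a_n\}$, $\ulcorner a_i\urcorner_\Delta := \lambda x_1.\dots\lambda x_n.x_i$, $\ulcorner \varepsilon\urcorner_{\Delta^*} := \lambda x_1.\dots\lambda x_n.\lambda y.y$, $\ulcorner a_i r\urcorner_{\Delta^*} := \lambda x_1.\dots\lambda x_n.\lambda y.x_i\,\ulcorner r\urcorner_{\Delta^*}$. $\Sigma_\Box$ is $\Sigma$ with a fresh blank symbol $\Box$ added as the last element of the order. -}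

module Defs where

open import Data.Nat using (ℕ; zero; suc; _+_; _*_; _∸_; _≤_; _<_; _<ᵇ_; _≡ᵇ_)
open import Data.Bool using (if_then_else_)
open import Data.Fin using (Fin; toℕ; fromℕ; inject₁)
open import Data.List using (List; []; _∷_; map; length)
open import Data.Product using (Σ; _×_)

-- Λ_det with de Bruijn indices:
--   terms  t ::= v | t v        values v ::= λ.t | x
mutual
  data Tm : Set where
    val : Val → Tm
    app : Tm → Val → Tm

  data Val : Set where
    var : ℕ → Val
    lam : Tm → Val

mutual
  shiftT : ℕ → Tm → Tm
  shiftT c (val v)   = val (shiftV c v)
  shiftT c (app t v) = app (shiftT c t) (shiftV c v)

  shiftV : ℕ → Val → Val
  shiftV c (var x) = if x <ᵇ c then var x else var (suc x)
  shiftV c (lam t) = lam (shiftT (suc c) t)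

mutual
  substT : ℕ → Val → Tm → Tm
  substT j s (val v)   = val (substV j s v)
  substT j s (app t v) = app (substT j s t) (substV j s v)

  substV : ℕ → Val → Val → Val
  substV j s (var x) =
    if x ≡ᵇ j then s else (if x <ᵇ j then var x else var (x ∸ 1))
  substV j s (lam t) = lam (substT (suc j) (shiftV 0 s) t)

_[_] : Tm → Val → Tm
t [ s ] = substT 0 s t

data _⟶_ : Tm → Tm → Set where
  β : ∀ {t s} → app (val (lam t)) s ⟶ (t [ s ])
  ξ : ∀ {t t' v} → t ⟶ t' → app t v ⟶ app t' v

data _⟶[_]_ : Tm → ℕ → Tm → Set where
  done : ∀ {t} → t ⟶[ 0 ] t
  step : ∀ {t u w n} → t ⟶ u → u ⟶[ n ] w → t ⟶[ suc n ] w

mutual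
  ScopedT : ℕ → Tm → Set
  ScopedT n (val v)   = ScopedV n v
  ScopedT n (app t v) = ScopedT n t × ScopedV n v

  ScopedV : ℕ → Val → Set
  ScopedV n (var x) = x < n
  ScopedV n (lam t) = ScopedT (suc n) t

ClosedTm : Tm → Set
ClosedTm = ScopedT 0

lams : ℕ → Tm → Val
lams zero    t = lam t
lams (suc n) t = lam (val (lams n t))
-- note: lams n t = λ^{n+1}. t

-- Scott encoding of strings over an ordered alphabet {a_1,…,a_m} ≅ Fin m
-- (letter i : Fin m is a_{i+1}).  With binders x_1 … x_m y, the de Bruijn index
-- of y is 0 and that of x_{i+1} is m ∸ i.
scottStr : (m : ℕ) → List (Fin m) → Val
scottStr m []      = lams m (val (var 0))
scottStr m (a ∷ r) = lams m (app (val (var (m ∸ toℕ a))) (scottStr m r))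

-- Σ_□ = Σ ∪ {□}, □ the last letter; Σ embeds order-preservingly
blank : (m : ℕ) → Fin (suc m)
blank m = fromℕ m

liftStr : {m : ℕ} → List (Fin m) → List (Fin (suc m))
liftStr = map inject₁

module Submission where

-- lift k s  ↦  loop loop s k, where loop is a self-applied recursion in continuation-passing style:
-- loop loop ⌜s⌝ applies the Scott string to one branch per letter of Σ_□, so the branch of the head
-- letter a is selected in m + 1 β-steps; it lifts the tail recursively and hands the result to the
-- continuation push a, which conses the lifted letter. Every letter thus costs m + 6 steps, a
-- constant once Σ is fixed, and the whole reduction takes (6 + m)(|s| + 1) steps.

open import Defs
open import Data.Nat using (ℕ; zero; suc; _+_; _*_; _∸_; _≤_; _<_; _<ᵇ_; _≡ᵇ_; z≤n; s≤s; _<?_)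
open import Data.Nat.Properties
open import Data.Nat.Tactic.RingSolver using (solve-∀)
open import Data.Bool using (true; false)
open import Data.Fin using (Fin; toℕ; inject₁)
open import Data.Fin.Properties using (toℕ<n; toℕ-inject₁)
open import Data.List using (List; []; _∷_; length)
open import Data.Vec using (Vec; []; _∷_; map)
open import Data.Vec.Relation.Unary.All using (All; []; _∷_)
open import Data.Product using (_×_; ∃-syntax; _,_)
open import Function using (_∘_)
open import Relation.Nullary using (yes; no; contradiction)
open import Relation.Binary.PropositionalEquality hiding ([_])
open ≡-Reasoning

<ᵇ-true : ∀ {x j} → x < j → (x <ᵇ j) ≡ true
<ᵇ-true (s≤s z≤n)        = refl
<ᵇ-true (s≤s (s≤s x<j)) = <ᵇ-true (s≤s x<j)

<ᵇ-false : ∀ {x j} → j ≤ x → (x <ᵇ j) ≡ false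
<ᵇ-false z≤n       = refl
<ᵇ-false (s≤s j≤x) = <ᵇ-false j≤x

≡ᵇ-refl : ∀ x → (x ≡ᵇ x) ≡ true
≡ᵇ-refl zero    = refl
≡ᵇ-refl (suc x) = ≡ᵇ-refl x

≡ᵇ-false : ∀ {x j} → x ≢ j → (x ≡ᵇ j) ≡ false
≡ᵇ-false {zero}  {zero}  x≢j = contradiction refl x≢j
≡ᵇ-false {zero}  {suc j} _   = refl
≡ᵇ-false {suc x} {zero}  _   = refl
≡ᵇ-false {suc x} {suc j} x≢j = ≡ᵇ-false (x≢j ∘ cong suc)

shiftV-var-< : ∀ {c x} → x < c → shiftV c (var x) ≡ var x
shiftV-var-< x<c rewrite <ᵇ-true x<c = refl

shiftV-var-≥ : ∀ {c x} → c ≤ x → shiftV c (var x) ≡ var (suc x)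
shiftV-var-≥ c≤x rewrite <ᵇ-false c≤x = refl

substV-var-< : ∀ {j x} s → x < j → substV j s (var x) ≡ var x
substV-var-< s x<j rewrite ≡ᵇ-false (<⇒≢ x<j) | <ᵇ-true x<j = refl

substV-var-≡ : ∀ j s → substV j s (var j) ≡ s
substV-var-≡ j s rewrite ≡ᵇ-refl j = refl

substV-var-> : ∀ {j x} s → j < x → substV j s (var x) ≡ var (x ∸ 1)
substV-var-> s j<x rewrite ≡ᵇ-false (>⇒≢ j<x) | <ᵇ-false (<⇒≤ j<x) = refl

ClosedV : Val → Set
ClosedV = ScopedV 0

mutual
  ScopedT-weaken : ∀ {n n'} t → n ≤ n' → ScopedT n t → ScopedT n' t
  ScopedT-weaken (val v)   n≤n' sv         = ScopedV-weaken v n≤n' sv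
  ScopedT-weaken (app t v) n≤n' (st , sv) = ScopedT-weaken t n≤n' st , ScopedV-weaken v n≤n' sv

  ScopedV-weaken : ∀ {n n'} v → n ≤ n' → ScopedV n v → ScopedV n' v
  ScopedV-weaken (var x) n≤n' x<n = ≤-trans x<n n≤n'
  ScopedV-weaken (lam t) n≤n' st  = ScopedT-weaken t (s≤s n≤n') st

mutual
  shiftT-id : ∀ {n c} t → n ≤ c → ScopedT n t → shiftT c t ≡ t
  shiftT-id (val v)   n≤c sv         = cong val (shiftV-id v n≤c sv)
  shiftT-id (app t v) n≤c (st , sv) = cong₂ app (shiftT-id t n≤c st) (shiftV-id v n≤c sv)

  shiftV-id : ∀ {n c} v → n ≤ c → ScopedV n v → shiftV c v ≡ v
  shiftV-id (var x) n≤c x<n = shiftV-var-< (≤-trans x<n n≤c)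
  shiftV-id (lam t) n≤c st  = cong lam (shiftT-id t (s≤s n≤c) st)

mutual
  substT-id : ∀ {n j} s t → n ≤ j → ScopedT n t → substT j s t ≡ t
  substT-id s (val v)   n≤j sv         = cong val (substV-id s v n≤j sv)
  substT-id s (app t v) n≤j (st , sv) = cong₂ app (substT-id s t n≤j st) (substV-id s v n≤j sv)

  substV-id : ∀ {n j} s v → n ≤ j → ScopedV n v → substV j s v ≡ v
  substV-id s (var x) n≤j x<n = substV-var-< s (≤-trans x<n n≤j)
  substV-id s (lam t) n≤j st  = cong lam (substT-id (shiftV 0 s) t (s≤s n≤j) st)

shiftV-closed : ∀ {c} v → ClosedV v → shiftV c v ≡ v
shiftV-closed v cv = shiftV-id v z≤n cv

substV-closed : ∀ {j} s v → ClosedV v → substV j s v ≡ v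
substV-closed s v cv = substV-id s v z≤n cv

mutual
  substT-shiftT : ∀ j s t → substT j s (shiftT j t) ≡ t
  substT-shiftT j s (val v)   = cong val (substV-shiftV j s v)
  substT-shiftT j s (app t v) = cong₂ app (substT-shiftT j s t) (substV-shiftV j s v)

  substV-shiftV : ∀ j s v → substV j s (shiftV j v) ≡ v
  substV-shiftV j s (var x) with x <? j
  ... | yes x<j rewrite shiftV-var-< x<j = substV-var-< s x<j
  ... | no  x≮j rewrite shiftV-var-≥ (≮⇒≥ x≮j) = substV-var-> s (s≤s (≮⇒≥ x≮j))
  substV-shiftV j s (lam t) = cong lam (substT-shiftT (suc j) (shiftV 0 s) t)

lams-scoped : ∀ m n t → ScopedT (suc m + n) t → ScopedV n (lams m t)
lams-scoped zero    n t st = st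
lams-scoped (suc m) n t st =
  lams-scoped m (suc n) t (subst (λ k → ScopedT k t) (cong suc (sym (+-suc m n))) st)

scottStr-scoped : ∀ m s n → ScopedV n (scottStr m s)
scottStr-scoped m []      n = lams-scoped m n _ (s≤s z≤n)
scottStr-scoped m (a ∷ r) n =
  lams-scoped m n _ (s≤s (≤-trans (m∸n≤m m (toℕ a)) (m≤m+n m n)) , scottStr-scoped m r _)

substV-lams : ∀ n j v t → ClosedV v →
              substV j v (lams n t) ≡ lams n (substT (suc n + j) v t)
substV-lams zero    j v t cv = cong (λ u → lam (substT (suc j) u t)) (shiftV-closed v cv)
substV-lams (suc n) j v t cv = cong (λ u → lam (val u)) (begin
  substV (suc j) (shiftV 0 v) (lams n t)  ≡⟨ cong (λ u → substV (suc j) u (lams n t)) (shiftV-closed v cv) ⟩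
  substV (suc j) v (lams n t)             ≡⟨ substV-lams n (suc j) v t cv ⟩
  lams n (substT (suc n + suc j) v t)     ≡⟨ cong (λ k → lams n (substT (suc k) v t)) (+-suc n j) ⟩
  lams n (substT (suc (suc n) + j) v t)   ∎)

infixr 5 _◅◅_

_◅◅_ : ∀ {t u w a b} → t ⟶[ a ] u → u ⟶[ b ] w → t ⟶[ a + b ] w
done       ◅◅ q = q
step r p ◅◅ q = step r (p ◅◅ q)

ξ* : ∀ {t u n v} → t ⟶[ n ] u → app t v ⟶[ n ] app u v
ξ* done       = done
ξ* (step r p) = step (ξ r) (ξ* p)

⟶[]-resp-target : ∀ {t n u u'} → u ≡ u' → t ⟶[ n ] u → t ⟶[ n ] u'
⟶[]-resp-target refl r = r

⟶[]-resp-count : ∀ {t n n' u} → n ≡ n' → t ⟶[ n ] u → t ⟶[ n' ] u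
⟶[]-resp-count refl r = r

β-≡ : ∀ {t s u} → t [ s ] ≡ u → app (val (lam t)) s ⟶ u
β-≡ refl = β

apps : ∀ {n} → Tm → Vec Val n → Tm
apps t []       = t
apps t (v ∷ vs) = apps (app t v) vs

-- substs (v₀ ∷ … ∷ vₙ) t is what the β-steps of (λ^{n+1}. t) v₀ … vₙ leave:
-- v₀ replaces the outermost binder.
substs : ∀ {n} → Vec Val n → Tm → Tm
substs []                 t = t
substs {suc n} (v ∷ vs) t = substs vs (substT n v t)

apps-ξ : ∀ {n t u} (vs : Vec Val n) → t ⟶ u → apps t vs ⟶ apps u vs
apps-ξ []       r = r
apps-ξ (v ∷ vs) r = apps-ξ vs (ξ r)

apps-scoped : ∀ {n k} t (vs : Vec Val k) → ScopedT n t → All (ScopedV n) vs → ScopedT n (apps t vs)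
apps-scoped t []       st []          = st
apps-scoped t (v ∷ vs) st (sv ∷ svs) = apps-scoped (app t v) vs (st , sv) svs

substT-apps : ∀ {n} j w (vs : Vec Val n) t →
              substT j w (apps t vs) ≡ apps (substT j w t) (map (substV j w) vs)
substT-apps j w []       t = refl
substT-apps j w (v ∷ vs) t = substT-apps j w vs (app t v)

apps-lams : ∀ {n} t (vs : Vec Val (suc n)) → All ClosedV vs →
            apps (val (lams n t)) vs ⟶[ suc n ] substs vs t
apps-lams {zero}  t (v ∷ [])  _          = step β done
apps-lams {suc n} t (v ∷ vs) (cv ∷ cvs) = step (apps-ξ vs (β-≡ unfold)) (apps-lams _ vs cvs)
  where
  unfold : val (lams n t) [ v ] ≡ val (lams n (substT (suc n) v t))
  unfold = cong val (trans (substV-lams n 0 v t cv)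
                           (cong (λ k → lams n (substT k v t)) (+-identityʳ (suc n))))

substs-closed : ∀ {n} (vs : Vec Val n) w → ClosedV w → substs vs (val w) ≡ val w
substs-closed []                 w cw = refl
substs-closed {suc n} (v ∷ vs) w cw rewrite substV-closed {n} v w cw = substs-closed vs w cw

substs-app-closed : ∀ {n} (vs : Vec Val n) t w → ClosedV w → substs vs (app t w) ≡ app (substs vs t) w
substs-app-closed []                 t w cw = refl
substs-app-closed {suc n} (v ∷ vs) t w cw rewrite substV-closed {n} v w cw = substs-app-closed vs _ w cw

substs-var-top : ∀ {n} v (vs : Vec Val n) → ClosedV v → substs (v ∷ vs) (val (var n)) ≡ val v
substs-var-top {n} v vs cv rewrite substV-var-≡ n v = substs-closed vs v cv

substs-var-< : ∀ {n x} v (vs : Vec Val n) → x < n →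
               substs (v ∷ vs) (val (var x)) ≡ substs vs (val (var x))
substs-var-< v vs x<n rewrite substV-var-< v x<n = refl

module Lift (m : ℕ) where

  ret : Val → Val
  ret w = lam (app (val (var 0)) w)

  -- The Scott cons over Σ_□ of letter i onto w. Since w is placed under the m + 2 binders without
  -- shifting, push refers to its own argument there as var (3 + m).
  cons : ℕ → Val → Val
  cons i w = lams (suc m) (app (val (var (suc m ∸ i))) w)

  push : ℕ → Val
  push i = lam (val (ret (cons i (var (3 + m)))))

  endBranch : Val
  endBranch = ret (scottStr (suc m) [])

  -- Below the binders f, s of loop = λf.λs. …; the branch of letter i is λr. f f r (push i).
  branch₀ : ℕ → Val
  branch₀ i = lam (app (app (app (val (var 2)) (var 2)) (var 0)) (push i))

  branches₀ : (i n : ℕ) → Vec Val (suc n)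
  branches₀ i zero    = endBranch ∷ []
  branches₀ i (suc n) = branch₀ i ∷ branches₀ (suc i) n

  loop : Val
  loop = lam (val (lam (apps (val (var 0)) (branches₀ 0 m))))

  loop² : Tm
  loop² = app (val loop) loop

  branch : ℕ → Val
  branch i = lam (app (app loop² (var 0)) (push i))

  branches : (i n : ℕ) → Vec Val (suc n)
  branches i zero    = endBranch ∷ []
  branches i (suc n) = branch i ∷ branches (suc i) n

  lift : Tm
  lift = val (lam (val (lam (app (app loop² (var 0)) (var 1)))))

  ⌜_⌝ : List (Fin m) → Val
  ⌜ s ⌝ = scottStr (suc m) (liftStr s)

  ⌜⌝-closed : ∀ s → ClosedV ⌜ s ⌝
  ⌜⌝-closed s = scottStr-scoped (suc m) (liftStr s) 0

  push-closed : ∀ i → ClosedV (push i)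
  push-closed i = s≤s z≤n , lams-scoped (suc m) 2 _
    ( s≤s (≤-trans (m∸n≤m (suc m) i) (s≤s (m≤m+n m 2)))
    , s≤s (s≤s (≤-reflexive (sym (+-comm m 2)))))

  endBranch-closed : ClosedV endBranch
  endBranch-closed = s≤s z≤n , scottStr-scoped (suc m) [] 1

  branches₀-scoped : ∀ i n → All (ScopedV 2) (branches₀ i n)
  branches₀-scoped i zero    = ScopedV-weaken endBranch z≤n endBranch-closed ∷ []
  branches₀-scoped i (suc n) = branch₀-scoped ∷ branches₀-scoped (suc i) n
    where
    branch₀-scoped : ScopedV 2 (branch₀ i)
    branch₀-scoped = ((((s≤s (s≤s (s≤s z≤n)) , s≤s (s≤s (s≤s z≤n))) , s≤s z≤n)
                     , ScopedV-weaken (push i) z≤n (push-closed i)))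

  loop-closed : ClosedV loop
  loop-closed = apps-scoped (val (var 0)) (branches₀ 0 m) (s≤s z≤n) (branches₀-scoped 0 m)

  loop²-scoped : ∀ n → ScopedT n loop²
  loop²-scoped n = ScopedV-weaken loop z≤n loop-closed , ScopedV-weaken loop z≤n loop-closed

  loop²-subst : ∀ j w → substT j w loop² ≡ loop²
  loop²-subst j w = substT-id w loop² z≤n (loop²-scoped 0)

  branch-closed : ∀ i → ClosedV (branch i)
  branch-closed i = (loop²-scoped 1 , s≤s z≤n) , ScopedV-weaken (push i) z≤n (push-closed i)

  branches-closed : ∀ i n → All ClosedV (branches i n)
  branches-closed i zero    = endBranch-closed ∷ []
  branches-closed i (suc n) = branch-closed i ∷ branches-closed (suc i) n

  lift-closed : ClosedTm lift
  lift-closed = (loop²-scoped 2 , s≤s z≤n) , s≤s (s≤s z≤n)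

  branches₀-subst : ∀ w i n →
                    map (substV 0 w) (map (substV 1 loop) (branches₀ i n)) ≡ branches i n
  branches₀-subst w i zero = cong (_∷ []) (begin
    substV 0 w (substV 1 loop endBranch)  ≡⟨ cong (substV 0 w) (substV-closed loop endBranch endBranch-closed) ⟩
    substV 0 w endBranch                  ≡⟨ substV-closed w endBranch endBranch-closed ⟩
    endBranch                             ∎)
  branches₀-subst w i (suc n) =
    cong₂ _∷_ (cong lam (cong₂ app (cong (λ t → app t (var 0)) loop²≡) push≡))
              (branches₀-subst w (suc i) n)
    where
    loop²≡ : substT 1 (shiftV 0 w) (substT 2 (shiftV 0 loop) (app (val (var 2)) (var 2))) ≡ loop²
    loop²≡ = trans (cong (substT 1 (shiftV 0 w)) (cong₂ app (cong val loop↑) loop↑))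
                   (loop²-subst 1 (shiftV 0 w))
      where
      loop↑ : shiftV 0 loop ≡ loop
      loop↑ = shiftV-closed loop loop-closed
    push≡ : substV 1 (shiftV 0 w) (substV 2 (shiftV 0 loop) (push i)) ≡ push i
    push≡ = trans (cong (substV 1 (shiftV 0 w)) (substV-closed (shiftV 0 loop) (push i) (push-closed i)))
                  (substV-closed (shiftV 0 w) (push i) (push-closed i))

  cons-subst : ∀ i w → ClosedV w → substV 1 w (cons i (var (3 + m))) ≡ cons i w
  cons-subst i w cw = trans (substV-lams (suc m) 1 w _ cw)
                            (cong (lams (suc m)) (cong₂ app (cong val letter≡) hole≡))
    where
    letter≡ : substV (suc (suc m) + 1) w (var (suc m ∸ i)) ≡ var (suc m ∸ i)
    letter≡ = substV-var-< w (s≤s (≤-trans (m∸n≤m (suc m) i) (s≤s (m≤m+n m 1))))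
    hole≡ : substV (suc (suc m) + 1) w (var (3 + m)) ≡ w
    hole≡ = subst (λ j → substV j w (var (3 + m)) ≡ w) (cong (suc ∘ suc) (sym (+-comm m 1)))
                  (substV-var-≡ (3 + m) w)

  loop-unfold : ∀ w → app loop² w ⟶[ 2 ] apps (val w) (branches 0 m)
  loop-unfold w = step (ξ β) (step (β-≡ body≡) done)
    where
    body₀ : Tm
    body₀ = apps (val (var 0)) (branches₀ 0 m)
    body≡ : substT 0 w (substT 1 (shiftV 0 loop) body₀) ≡ apps (val w) (branches 0 m)
    body≡ = begin
      substT 0 w (substT 1 (shiftV 0 loop) body₀)
        ≡⟨ cong (λ u → substT 0 w (substT 1 u body₀)) (shiftV-closed loop loop-closed) ⟩
      substT 0 w (substT 1 loop body₀)
        ≡⟨ cong (substT 0 w) (substT-apps 1 loop (branches₀ 0 m) (val (var 0))) ⟩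
      substT 0 w (apps (val (var 0)) (map (substV 1 loop) (branches₀ 0 m)))
        ≡⟨ substT-apps 0 w (map (substV 1 loop) (branches₀ 0 m)) (val (var 0)) ⟩
      apps (val w) (map (substV 0 w) (map (substV 1 loop) (branches₀ 0 m)))
        ≡⟨ cong (apps (val w)) (branches₀-subst w 0 m) ⟩
      apps (val w) (branches 0 m) ∎

  branches-end : ∀ i n → substs (branches i n) (val (var 0)) ≡ val endBranch
  branches-end i zero    = refl
  branches-end i (suc n) =
    trans (substs-var-< (branch i) (branches (suc i) n) (s≤s z≤n)) (branches-end (suc i) n)

  branches-letter : ∀ i n x → x < n → substs (branches i n) (val (var (n ∸ x))) ≡ val (branch (i + x))
  branches-letter i (suc n) zero _ rewrite +-identityʳ i =
    substs-var-top (branch i) (branches (suc i) n) (branch-closed i)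
  branches-letter i (suc n) (suc x) (s≤s x<n) rewrite +-suc i x =
    trans (substs-var-< (branch i) (branches (suc i) n) (s≤s (m∸n≤m n x))) (branches-letter (suc i) n x x<n)

  dispatch-nil : apps (val (scottStr m [])) (branches 0 m) ⟶[ suc m ] val endBranch
  dispatch-nil = ⟶[]-resp-target (branches-end 0 m) (apps-lams _ (branches 0 m) (branches-closed 0 m))

  dispatch-cons : ∀ a r →
    apps (val (scottStr m (a ∷ r))) (branches 0 m) ⟶[ suc m ] app (val (branch (toℕ a))) (scottStr m r)
  dispatch-cons a r = ⟶[]-resp-target selected (apps-lams _ (branches 0 m) (branches-closed 0 m))
    where
    selected : substs (branches 0 m) (app (val (var (m ∸ toℕ a))) (scottStr m r))
               ≡ app (val (branch (toℕ a))) (scottStr m r)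
    selected = trans (substs-app-closed (branches 0 m) _ _ (scottStr-scoped m r 0))
                     (cong (λ u → app u (scottStr m r)) (branches-letter 0 m (toℕ a) (toℕ<n a)))

  branch-apply : ∀ i w → ClosedV w → app (val (branch i)) w ⟶ app (app loop² w) (push i)
  branch-apply i w cw =
    β-≡ (cong₂ app (cong (λ t → app t w) (loop²-subst 0 w)) (substV-closed w (push i) (push-closed i)))

  ret-apply : ∀ w k → ClosedV w → app (val (ret w)) k ⟶ app (val k) w
  ret-apply w k cw = β-≡ (cong (app (val k)) (substV-closed k w cw))

  push-apply : ∀ i w → ClosedV w → app (val (push i)) w ⟶ val (ret (cons i w))
  push-apply i w cw = β-≡ (cong (val ∘ ret) (begin
    substV 1 (shiftV 0 w) (cons i (var (3 + m)))  ≡⟨ cong (λ u → substV 1 u (cons i (var (3 + m)))) (shiftV-closed w cw) ⟩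
    substV 1 w (cons i (var (3 + m)))             ≡⟨ cons-subst i w cw ⟩
    cons i w                                      ∎))

  loop-correct : ∀ s → app loop² (scottStr m s) ⟶[ length s * (6 + m) + (3 + m) ] val (ret ⌜ s ⌝)
  loop-correct []      = loop-unfold _ ◅◅ dispatch-nil
  loop-correct (a ∷ r) = ⟶[]-resp-count (count (length r) m)
    (loop-unfold _ ◅◅ dispatch-cons a r ◅◅
     step (branch-apply (toℕ a) _ (scottStr-scoped m r 0))
          (ξ* (loop-correct r) ◅◅
           step (ret-apply ⌜ r ⌝ (push (toℕ a)) (⌜⌝-closed r))
                (step (push-apply (toℕ a) ⌜ r ⌝ (⌜⌝-closed r)) lifted)))
    where
    lifted : val (ret (cons (toℕ a) ⌜ r ⌝)) ⟶[ 0 ] val (ret ⌜ a ∷ r ⌝)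
    lifted = ⟶[]-resp-target (cong (λ i → val (ret (cons i ⌜ r ⌝))) (sym (toℕ-inject₁ a))) done
    count : ∀ l m → 2 + (suc m + suc (l * (6 + m) + (3 + m) + 2)) ≡ suc l * (6 + m) + (3 + m)
    count = solve-∀

  lift-correct : ∀ k s →
    app (app lift k) (scottStr m s) ⟶[ (6 + m) * length s + (6 + m) ] app (val k) ⌜ s ⌝
  lift-correct k s = ⟶[]-resp-count (count (length s) m)
    (step (ξ β) (step (β-≡ enter)
      (ξ* (loop-correct s) ◅◅ step (ret-apply ⌜ s ⌝ k (⌜⌝-closed s)) done)))
    where
    enter : substT 0 (scottStr m s) (substT 1 (shiftV 0 k) (app (app loop² (var 0)) (var 1)))
            ≡ app (app loop² (scottStr m s)) k
    enter = cong₂ app (cong (λ t → app t (scottStr m s))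
                            (trans (cong (substT 0 (scottStr m s)) (loop²-subst 1 (shiftV 0 k)))
                                   (loop²-subst 0 (scottStr m s))))
                      (substV-shiftV 0 (scottStr m s) k)
    count : ∀ l m → 2 + (l * (6 + m) + (3 + m) + 1) ≡ (6 + m) * l + (6 + m)
    count = solve-∀

lemma3 : (m : ℕ) →
    ∃[ lift ] (ClosedTm lift ×
      ∃[ A ] ∃[ B ] ∃[ C ] ∃[ D ]
        ((k : Val) → (s : List (Fin m)) →
          ∃[ n ] ((app (app lift k) (scottStr m s) ⟶[ n ] app (val k) (scottStr (suc m) (liftStr s)))
                  × n ≤ A * length s + B
                  × length s ≤ C * n + D)))
lemma3 m = lift , lift-closed , 6 + m , 6 + m , 1 , 0 , λ k s →
  _ , lift-correct k s , ≤-refl , length≤steps (length s)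
  where
  open Lift m
  length≤steps : ∀ l → l ≤ 1 * ((6 + m) * l + (6 + m)) + 0
  length≤steps l rewrite +-identityʳ (1 * ((6 + m) * l + (6 + m))) | *-identityˡ ((6 + m) * l + (6 + m)) =
    ≤-trans (m≤n*m l (6 + m)) (m≤m+n _ _)
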